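{- There exists a structure of cardinality $3$ that is a model of $(\Sigma^\sharp \setminus \{B1\}) \cup \{\neg B1\}$, where $\Sigma^\sharp$ is the axiom system described in the context.
   Context: Work in classical one-sorted first-order logic with equality, in the language with three constant symbols $a_0, a_1, a_2$, a ternary relation symbol $L$ (collinearity) and a ternary function symbol $\tau$. Write $\sigma(a,b)$ as an abbreviation for $\tau(b,a,a)$. The axioms below are understood as universally closed: A3: $a \ne b \wedge L(a,b,c) \wedge L(a,b,d) \rightarrow L(a,c,d)$; B1: $L(a,b,c) \rightarrow L(b,a,c)$; B2: $\tau(a,b,c) = \tau(a,c,b)$; B3: $L(a,b,\sigma(a,b))$; B4: $L(a,b,c) \rightarrow L(x, \tau(a,b,x), \tau(a,c,x))$; B6: $\tau(a,b,x) = \tau(c, \tau(a,b,x), x)$; B7: $\neg L(a_0,a_1,a_2)$; B8: $\sigma(a,b) = b \rightarrow a = b$. $\Sigma^\sharp$ is the set $\{A3,B1,B2,B3,B4,B6,B7,B8\}$. -}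

module Defs where

open import Data.Fin using (Fin)
open import Data.Product using (_×_)
open import Data.Empty using (⊥)
open import Relation.Nullary using (¬_)
open import Relation.Binary.PropositionalEquality using (_≡_; _≢_)
open import Function.Bundles using (_↔_)
open import Level using (Level; suc; _⊔_)

-- A structure for the language {a₀, a₁, a₂, L, τ}:
-- carrier, three constants, a ternary relation L, a ternary function τ.
-- Equality of the language is interpreted as propositional equality.
record Structure (c ℓ : Level) : Set (suc (c ⊔ ℓ)) where
  field
    Carrier : Set c
    a₀ a₁ a₂ : Carrier
    L : Carrier → Carrier → Carrier → Set ℓ
    τ : Carrier → Carrier → Carrier → Carrier

module _ {c ℓ : Level} (M : Structure c ℓ) where
  open Structure M

  σ : Carrier → Carrier → Carrier
  σ a b = τ b a a

  A3 : Set (c ⊔ ℓ)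
  A3 = ∀ a b c d → a ≢ b → L a b c → L a b d → L a c d

  B1 : Set (c ⊔ ℓ)
  B1 = ∀ a b c → L a b c → L b a c

  B2 : Set c
  B2 = ∀ a b c → τ a b c ≡ τ a c b

  B3 : Set (c ⊔ ℓ)
  B3 = ∀ a b → L a b (σ a b)

  B4 : Set (c ⊔ ℓ)
  B4 = ∀ a b c x → L a b c → L x (τ a b x) (τ a c x)

  B6 : Set c
  B6 = ∀ a b c x → τ a b x ≡ τ c (τ a b x) x

  B7 : Set ℓ
  B7 = ¬ L a₀ a₁ a₂

  B8 : Set c
  B8 = ∀ a b → σ a b ≡ b → a ≡ b

  ModelΣ♯¬B1 : Set (c ⊔ ℓ)
  ModelΣ♯¬B1 = A3 × (¬ B1) × B2 × B3 × B4 × B6 × B7 × B8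

  HasCardinality : (n : _) → Set c
  HasCardinality n = Carrier ↔ Fin n

-- Take the meet-semilattice with a bottom and two incomparable atoms, let
-- τ(a, b, c) = b ⊓ c and let L(a, b, c) say c ≤ a.  Then σ(a, b) = a ⊓ a = a, so
-- B3 and B8 are immediate, B2 and B6 are commutativity and idempotence of ⊓,
-- and A3 and B4 hold because L only constrains its third argument to lie below
-- its first.  As L ignores its second argument it cannot be symmetric in the
-- first two: L(atom, bot, atom) holds but atom ≤ bot does not, refuting B1.
module Submission where

open import Defs
open import Level using (0ℓ)
open import Data.Product using (Σ-syntax; _×_; _,_)
open import Data.Fin using (Fin; zero; suc)
open import Relation.Nullary using (¬_)
open import Relation.Binary.PropositionalEquality using (_≡_; refl; sym; trans)
open import Function.Properties.Inverse using (↔-refl)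

pattern bot   = zero
pattern atom₁ = suc zero
pattern atom₂ = suc (suc zero)

infixr 7 _⊓_
infix 4 _≼_

_⊓_ : Fin 3 → Fin 3 → Fin 3
bot   ⊓ y     = bot
atom₁ ⊓ bot   = bot
atom₁ ⊓ atom₁ = atom₁
atom₁ ⊓ atom₂ = bot
atom₂ ⊓ bot   = bot
atom₂ ⊓ atom₁ = bot
atom₂ ⊓ atom₂ = atom₂

data _≼_ : Fin 3 → Fin 3 → Set where
  bot≼   : ∀ {x} → bot ≼ x
  ≼-refl : ∀ {x} → x ≼ x

⊓-comm : ∀ x y → x ⊓ y ≡ y ⊓ x
⊓-comm bot   bot   = refl
⊓-comm bot   atom₁ = refl
⊓-comm bot   atom₂ = refl
⊓-comm atom₁ bot   = refl
⊓-comm atom₁ atom₁ = refl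
⊓-comm atom₁ atom₂ = refl
⊓-comm atom₂ bot   = refl
⊓-comm atom₂ atom₁ = refl
⊓-comm atom₂ atom₂ = refl

⊓-idem : ∀ x → x ⊓ x ≡ x
⊓-idem bot   = refl
⊓-idem atom₁ = refl
⊓-idem atom₂ = refl

x⊓y≼y : ∀ x y → x ⊓ y ≼ y
x⊓y≼y bot   y     = bot≼
x⊓y≼y atom₁ bot   = bot≼
x⊓y≼y atom₁ atom₁ = ≼-refl
x⊓y≼y atom₁ atom₂ = bot≼
x⊓y≼y atom₂ bot   = bot≼
x⊓y≼y atom₂ atom₁ = bot≼
x⊓y≼y atom₂ atom₂ = ≼-refl

≼⇒⊓≡ : ∀ {x y} → x ≼ y → x ⊓ y ≡ x
≼⇒⊓≡ bot≼       = refl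
≼⇒⊓≡ {x} ≼-refl = ⊓-idem x

semilatticeStructure : Structure 0ℓ 0ℓ
semilatticeStructure = record
  { Carrier = Fin 3
  ; a₀ = bot ; a₁ = atom₁ ; a₂ = atom₂
  ; L = λ a _ c → c ≼ a
  ; τ = λ _ b c → b ⊓ c
  }

a3 : A3 semilatticeStructure
a3 _ _ _ _ _ _ d≼a = d≼a

¬b1 : ¬ B1 semilatticeStructure
¬b1 b1 with b1 atom₁ bot atom₁ ≼-refl
... | ()

b2 : B2 semilatticeStructure
b2 _ = ⊓-comm

b3 : B3 semilatticeStructure
b3 a _ rewrite ⊓-idem a = ≼-refl

b4 : B4 semilatticeStructure
b4 _ _ c x _ = x⊓y≼y c x

b6 : B6 semilatticeStructure
b6 _ b _ x = sym (≼⇒⊓≡ (x⊓y≼y b x))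

b7 : B7 semilatticeStructure
b7 ()

b8 : B8 semilatticeStructure
b8 a _ σab≡b = trans (sym (⊓-idem a)) σab≡b

proposition4 : Σ[ M ∈ Structure 0ℓ 0ℓ ] (HasCardinality M 3 × ModelΣ♯¬B1 M)
proposition4 =
  semilatticeStructure , ↔-refl , a3 , ¬b1 , b2 , b3 , b4 , b6 , b7 , b8
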